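{- Let $k,m$ be positive integers and let $\mathcal P=\{P_1,\dots,P_k\}$ be patterns with $m_i=|P_i|\ge 2k\log m$. For each $i$ and $j\ge 0$ let $P_{i,j}$ denote the prefix of $P_i$ of length $2^j$ and $\rho_{i,j}$ its period. Let $D_1$ be the set containing, for each $i$, the longest $P_{i,j}$ with $\rho_{i,j}<k\log m$ and $2k\log m\le|P_{i,j}|\le m_i-2k\log m$, if such a $P_{i,j}$ exists (otherwise nothing is included for $P_i$). If $P_{i,j},P_{i',j'}\in D_1$ and $P_{i,j}$ is a suffix of $P_{i',j'}$, then the periods of $P_{i,j}$ and $P_{i',j'}$ are equal.
   Context: An integer $p$ with $0<p\le|x|$ is a period of a nonempty string $x$ if $x_i=x_{i+p}$ for all valid $i$; "the period" of $x$ means its smallest period. Logarithms are base 2, rounded to the nearest integer. -}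

module Defs where

open import Data.Nat using (ℕ; zero; suc; _+_; _*_; _∸_; _^_; _≤_; _<_)
open import Data.Nat.Logarithm using (⌊log₂_⌋)
open import Data.Nat.DivMod using (_/_)
open import Data.Fin using (Fin; fromℕ<)
open import Data.List using (List; length; lookup; take; _++_)
open import Data.Product using (Σ; ∃; _×_)
open import Relation.Binary.PropositionalEquality using (_≡_)

-- log₂ m rounded to the nearest integer (for m ≥ 1):
-- round(log₂ m) = ⌊log₂ m + 1/2⌋ = ⌊ log₂(2 m²) / 2 ⌋ = ⌊ ⌊log₂(2 m²)⌋ / 2 ⌋
-- (no ties occur, since log₂ m + 1/2 is never an integer for m ≥ 1).
logR : ℕ → ℕ
logR m = ⌊log₂ (2 * (m * m)) ⌋ / 2

module _ {A : Set} where

  IsPeriod : List A → ℕ → Set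
  IsPeriod x p = (0 < p) × (p ≤ length x) ×
    (∀ i (h₁ : i < length x) (h₂ : i + p < length x) →
       lookup x (fromℕ< h₁) ≡ lookup x (fromℕ< h₂))

  IsThePeriod : List A → ℕ → Set
  IsThePeriod x ρ = IsPeriod x ρ × (∀ q → IsPeriod x q → ρ ≤ q)

  IsSuffix : List A → List A → Set
  IsSuffix x y = ∃ λ u → u ++ x ≡ y

  pref : List A → ℕ → List A
  pref P j = take (2 ^ j) P

  -- P_{i,j} qualifies for D₁ (with K = k log m):
  -- ρ_{i,j} < K and 2K ≤ |P_{i,j}| ≤ m_i − 2K  (here |P_{i,j}| = 2^j since 2^j ≤ m_i)
  Qualifies : ℕ → List A → ℕ → Set
  Qualifies K P j =
    (Σ ℕ λ ρ → IsThePeriod (pref P j) ρ × ρ < K) ×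
    (2 * K ≤ 2 ^ j) × (2 ^ j ≤ length P ∸ 2 * K) × (2 ^ j ≤ length P)

  InD₁ : ℕ → List A → ℕ → Set
  InD₁ K P j = Qualifies K P j × (∀ j' → Qualifies K P j' → j' ≤ j)

module Submission where

-- Let x = P_{i,j} be a suffix of y = P_{i',j'}, say y = u ++ x, and
-- let ρ, ρ' be the periods of x and y.  Membership in D₁ gives ρ, ρ' < K = k log m
-- and |x| = 2^j ≥ 2K, hence ρ' + ρ ≤ |x|.  Two general facts about periods then
-- give the two inequalities between ρ and ρ':
--   * a period p of u ++ x with p ≤ |x| is a period of the suffix x
--     (so ρ' is a period of x, and ρ ≤ ρ');
--   * if u ++ x has period p, x has period q and p + q ≤ |x|, then q is a period
--     of the whole word u ++ x (so ρ is a period of y, and ρ' ≤ ρ).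

open import Defs
open import Data.Nat using (ℕ; zero; suc; _*_; _+_; _^_; _≤_; _<_; s≤s; s<s⁻¹)
open import Data.Nat.Properties
open import Data.Fin using (Fin; fromℕ<)
open import Data.List using (List; length; lookup; _++_; _∷_; [])
open import Data.List.Properties using (length-++; length-take)
open import Data.Product using (_,_; proj₁)
open import Relation.Binary.PropositionalEquality

module _ {A : Set} where

  lookup-cong : (x : List A) {i j : ℕ} → i ≡ j →
                (h : i < length x) (h' : j < length x) →
                lookup x (fromℕ< h) ≡ lookup x (fromℕ< h')
  lookup-cong x refl h h' = refl

  suffix-length : (u x : List A) → length x ≤ length (u ++ x)
  suffix-length u x = subst (length x ≤_) (sym (length-++ u)) (m≤n+m (length x) (length u))

  tail-period : ∀ {a : A} {w p} → IsPeriod (a ∷ w) p → p ≤ length w → IsPeriod w p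
  tail-period (p>0 , _ , per) p≤w =
    p>0 , p≤w , λ i h₁ h₂ → per (suc i) (s≤s h₁) (s≤s h₂)

  -- The new position 0 is linked to q through the chain
  -- y[0] = y[p] = y[p + q] = y[q + p] = y[q], using p on y and q on w.
  cons-period : ∀ {a : A} {w p q} → IsPeriod (a ∷ w) p → IsPeriod w q →
                p + q ≤ length w → IsPeriod (a ∷ w) q
  cons-period {p = zero} (() , _)
  cons-period {a} {w} {suc p'} {q} (_ , _ , perY) (q>0 , q≤w , perW) pq≤w =
    q>0 , m≤n⇒m≤1+n q≤w , shift
    where
    y = a ∷ w
    hp : suc p' < length y
    hp = s≤s (≤-trans (m≤m+n (suc p') q) pq≤w)
    hpq : suc p' + q < length y
    hpq = s≤s pq≤w
    hqp : q + suc p' < length y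
    hqp = subst (_< length y) (+-comm (suc p') q) hpq
    shift : ∀ i (h₁ : i < length y) (h₂ : i + q < length y) →
            lookup y (fromℕ< h₁) ≡ lookup y (fromℕ< h₂)
    shift zero h₁ h₂ = begin
      lookup y (fromℕ< h₁)  ≡⟨ perY 0 h₁ hp ⟩
      lookup y (fromℕ< hp)  ≡⟨ perW p' (s<s⁻¹ hp) (s<s⁻¹ hpq) ⟩
      lookup y (fromℕ< hpq) ≡⟨ lookup-cong y (+-comm (suc p') q) hpq hqp ⟩
      lookup y (fromℕ< hqp) ≡⟨ sym (perY q h₂ hqp) ⟩
      lookup y (fromℕ< h₂)  ∎
      where open ≡-Reasoning
    shift (suc i) h₁ h₂ = perW i (s<s⁻¹ h₁) (s<s⁻¹ h₂)

  suffix-period : (u x : List A) {p : ℕ} → IsPeriod (u ++ x) p → p ≤ length x →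
                  IsPeriod x p
  suffix-period []      x per p≤x = per
  suffix-period (a ∷ u) x per p≤x =
    suffix-period u x (tail-period per (≤-trans p≤x (suffix-length u x))) p≤x

  extend-period : (u x : List A) {p q : ℕ} → IsPeriod (u ++ x) p → IsPeriod x q →
                  p + q ≤ length x → IsPeriod (u ++ x) q
  extend-period []      x perP perQ pq≤x = perQ
  extend-period (a ∷ u) x {p} {q} perP perQ pq≤x =
    cons-period perP (extend-period u x perPw perQ pq≤x) pq≤w
    where
    pq≤w : p + q ≤ length (u ++ x)
    pq≤w = ≤-trans pq≤x (suffix-length u x)
    perPw : IsPeriod (u ++ x) p
    perPw = tail-period perP (≤-trans (m≤m+n p q) pq≤w)

  -- If x is a suffix of y and their periods ρ, ρ' satisfy ρ' + ρ ≤ |x|,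
  -- then ρ = ρ': each is a period of the other word, so minimality gives ≤ both ways.
  suffix-periods-agree : {x y : List A} {ρ ρ' : ℕ} → IsSuffix x y →
                         IsThePeriod x ρ → IsThePeriod y ρ' →
                         ρ' + ρ ≤ length x → ρ ≡ ρ'
  suffix-periods-agree {x} {ρ = ρ} {ρ'} (u , refl) (perX , minX) (perY , minY) sum≤x =
    ≤-antisym (minX ρ' (suffix-period u x perY (≤-trans (m≤m+n ρ' ρ) sum≤x)))
              (minY ρ (extend-period u x perY perX sum≤x))

  period-below : {x : List A} {ρ ρ₀ K : ℕ} → IsThePeriod x ρ → IsPeriod x ρ₀ →
                 ρ₀ < K → ρ < K
  period-below {ρ₀ = ρ₀} (_ , minimal) per₀ ρ₀<K = ≤-<-trans (minimal ρ₀ per₀) ρ₀<K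

  pref-length : (P : List A) (j : ℕ) → 2 ^ j ≤ length P → length (pref P j) ≡ 2 ^ j
  pref-length P j fits = trans (length-take (2 ^ j) P) (m≤n⇒m⊓n≡m fits)

lemma4 : {A : Set} (k m : ℕ) → 0 < k → 0 < m →
    (P : Fin k → List A) →
    (∀ i → 2 * (k * logR m) ≤ length (P i)) →
    ∀ i j i' j' →
    InD₁ (k * logR m) (P i) j → InD₁ (k * logR m) (P i') j' →
    IsSuffix (pref (P i) j) (pref (P i') j') →
    ∀ ρ ρ' → IsThePeriod (pref (P i) j) ρ → IsThePeriod (pref (P i') j') ρ' →
    ρ ≡ ρ'
lemma4 k m _ _ P _ i j i' j'
  (((ρ₀ , period₀ , ρ₀<K) , 2K≤2^j , _ , fits) , _) (((ρ₁ , period₁ , ρ₁<K) , _) , _)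
  suffix ρ ρ' thePeriod thePeriod' =
  suffix-periods-agree suffix thePeriod thePeriod' sum≤x
  where
  K : ℕ
  K = k * logR m
  x y : List _
  x = pref (P i) j
  y = pref (P i') j'
  ρ<K : ρ < K
  ρ<K = period-below {x = x} thePeriod (proj₁ period₀) ρ₀<K
  ρ'<K : ρ' < K
  ρ'<K = period-below {x = y} thePeriod' (proj₁ period₁) ρ₁<K
  sum≤x : ρ' + ρ ≤ length x
  sum≤x = begin
    ρ' + ρ                  ≤⟨ +-mono-≤ (<⇒≤ ρ'<K) (<⇒≤ ρ<K) ⟩
    K + K                   ≡⟨ cong (K +_) (sym (+-identityʳ K)) ⟩
    2 * K                   ≤⟨ 2K≤2^j ⟩
    2 ^ j                   ≡⟨ sym (pref-length (P i) j fits) ⟩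
    length x                ∎
    where open ≤-Reasoning
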